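{- Let $\pi=\alpha\oplus(1\ominus\beta)\in\mathrm{Av}(231)$, with $\alpha,\beta\in\mathrm{Av}(231)$, be such that $P$ restricts to a size-preserving bijection from $\mathrm{Av}(231,\pi)$ onto $\mathrm{Av}(132,P(\pi))$. Then $\beta$ ends with its maximum.
   Context: Patterns. - $\mathrm{Av}(B)$ is the set of permutations avoiding every pattern in $B$. Sums and the bijection $P$. - $\alpha\oplus\beta=\alpha(\beta+|\alpha|)$ and $\alpha\ominus\beta=(\alpha+|\beta|)\beta$. - Every nonempty $\pi\in\mathrm{Av}(231)$ is uniquely $\alpha\oplus(1\ominus\beta)$ with $\alpha,\beta\in\mathrm{Av}(231)$, possibly empty. - $P:\mathrm{Av}(231)\to\mathrm{Av}(132)$ is the bijection defined by $P(\varepsilon)=\varepsilon$ and $P(\alpha\oplus(1\ominus\beta))=(P(\alpha)\oplus1)\ominus P(\beta)$. - "$P$ restricts to a bijection from $\mathrm{Av}(231,\pi)$ onto $\mathrm{Av}(132,P(\pi))$" means $P(\mathrm{Av}(231,\pi))=\mathrm{Av}(132,P(\pi))$. -}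

module Defs where

open import Data.Nat using (ℕ; zero; suc; _+_; _∸_; _<_; _⊔_)
open import Data.Nat.Properties using (_≟_)
open import Data.List using (List; []; _∷_; _++_; map; length; upTo; foldr; span; drop; [_])
open import Data.List.Relation.Binary.Pointwise using (Pointwise)
open import Data.List.Relation.Binary.Sublist.Propositional using (_⊆_)
open import Data.List.Relation.Binary.Permutation.Propositional using (_↭_)
open import Data.Product using (Σ; ∃; _×_; _,_)
open import Data.Sum using (_⊎_)
open import Function.Bundles using (_⇔_)
open import Relation.Binary.PropositionalEquality using (_≡_)
open import Relation.Nullary using (¬_)
open import Relation.Nullary.Decidable using (¬?)

IsPerm : List ℕ → Set
IsPerm xs = xs ↭ map suc (upTo (length xs))

data OrdIso : List ℕ → List ℕ → Set where
  [] : OrdIso [] []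
  _∷_ : ∀ {x y xs ys} →
        Pointwise (λ a b → ((x < a) ⇔ (y < b)) × ((a < x) ⇔ (b < y))) xs ys →
        OrdIso xs ys → OrdIso (x ∷ xs) (y ∷ ys)

Contains : List ℕ → List ℕ → Set
Contains π σ = ∃ λ τ → (τ ⊆ π) × OrdIso τ σ

Avoids : List ℕ → List ℕ → Set
Avoids π σ = ¬ Contains π σ

InAv1 : List ℕ → List ℕ → Set
InAv1 σ π = IsPerm π × Avoids π σ

InAv2 : List ℕ → List ℕ → List ℕ → Set
InAv2 σ ρ π = IsPerm π × Avoids π σ × Avoids π ρ

p231 : List ℕ
p231 = 2 ∷ 3 ∷ 1 ∷ []

p132 : List ℕ
p132 = 1 ∷ 3 ∷ 2 ∷ []

_⊕_ : List ℕ → List ℕ → List ℕ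
α ⊕ β = α ++ map (_+ length α) β

_⊖_ : List ℕ → List ℕ → List ℕ
α ⊖ β = map (_+ length β) α ++ β

infixl 6 _⊕_ _⊖_

maxL : List ℕ → ℕ
maxL = foldr _⊔_ 0

-- The bijection P. For π ∈ Av(231) nonempty, π = α ⊕ (1 ⊖ β) where the
-- entry 1 of "1 ⊖ β" is the maximum of π; so α is the prefix before the
-- maximum and β is the suffix after it, shifted down by |α|.
Pf : ℕ → List ℕ → List ℕ
Pf zero _ = []
Pf (suc k) [] = []
Pf (suc k) (x ∷ xs) with span (λ y → ¬? (y ≟ maxL (x ∷ xs))) (x ∷ xs)
... | (α , r) = (Pf k α ⊕ [ 1 ]) ⊖ Pf k (map (_∸ length α) (drop 1 r))

P : List ℕ → List ℕ
P π = Pf (length π) π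

EndsWithMax : List ℕ → Set
EndsWithMax β = (β ≡ []) ⊎ (∃ λ γ → β ≡ γ ++ [ maxL β ])

PRestrictsBij : List ℕ → Set
PRestrictsBij π =
  (∀ σ → InAv2 p231 π σ → InAv2 p132 (P π) (P σ)) ×
  (∀ τ → InAv2 p132 (P π) τ → ∃ λ σ → InAv2 p231 π σ × (P σ ≡ τ))

module Submission where

-- Every nonempty β ∈ Av(231) splits at its maximum as β₁ ⊕ (1 ⊖ γ), since the entries before
-- the maximum lie below those after it. If γ is nonempty, put X = P α ⊕ 1 and Y = P β₁ ⊕ 1 and
-- take σ = (α ⊕ (1 ⊖ (β₁ ⊕ 1))) ⊕ (1 ⊖ γ) ∈ Av(231). Unfolding P,
--   P(π) = X ⊖ (Y ⊖ P γ) = (X ⊖ Y) ⊖ P γ   and   P(σ) = ((X ⊖ Y) ⊕ 1) ⊖ P γ,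
-- so P(σ) contains P(π). But σ avoids π: in an occurrence, the entry playing the maximum of π
-- comes after the first |α| entries of σ and is followed by |β| smaller entries, whereas after
-- position |α| the entries of σ form two blocks of sizes |β₁| + 2 and |γ| + 1, the first
-- entirely below the second, so every entry there has fewer than |β| smaller entries after it.
-- Hence P sends σ ∈ Av(231, π) outside Av(132, P(π)).

open import Defs
open import Data.Nat using (ℕ; zero; suc; _+_; _∸_; _<_; _≤_; z≤n; s≤s; s≤s⁻¹; z<s; s<s; _≤?_; _<?_)
open import Data.Nat.Properties
open import Data.List using (List; []; _∷_; _++_; map; length; upTo; drop; filter; span; [_])
open import Data.List.Properties
  using (upTo-∷ʳ; map-++; length-++; length-map; map-∘; map-cong; map-id; map-id-local; ++-assoc; ++-identityʳ;
         filter-++; filter-all; filter-none)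
open import Data.List.Membership.Propositional using (_∈_)
open import Data.List.Membership.Propositional.Properties using (∈-++⁺ˡ; ∈-++⁺ʳ; ∈-∃++)
open import Data.List.Relation.Unary.All as All using (All; []; _∷_)
import Data.List.Relation.Unary.All.Properties as All
open import Data.List.Relation.Unary.Any using (here; there)
open import Data.List.Relation.Unary.Unique.Propositional using (Unique; _∷_)
import Data.List.Relation.Unary.Unique.Propositional.Properties as Unique
open import Data.List.Relation.Binary.Permutation.Propositional
  using (_↭_; ↭-refl; ↭-sym; ↭-trans; ↭-reflexive; ↭⇒↭ₛ)
open import Data.List.Relation.Binary.Permutation.Propositional.Properties
  using (↭-length; ++⁺; ++-comm; map⁺; filter-↭; drop-mid; ∈-resp-↭)
import Data.List.Relation.Binary.Permutation.Setoid.Properties as PermₛProp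
open import Data.Product using (∃; ∃₂; _×_; _,_; proj₁; proj₂; swap)
open import Data.Sum as Sum using (_⊎_; inj₁; inj₂)
open import Data.Empty using (⊥; ⊥-elim)
open import Function.Base using (_∘_)
open import Function.Bundles using (_⇔_; mk⇔; Equivalence)
import Function.Properties.Equivalence as ⇔
open import Relation.Nullary using (¬_; yes; no)
open import Relation.Nullary.Decidable using (¬?; dec-true; dec-false)
open import Relation.Binary.Definitions using (tri<; tri≈; tri>)
open import Data.List.Relation.Binary.Sublist.Propositional
  using (_⊆_; []; _∷_; _∷ʳ_; ⊆-refl; ⊆-trans; lookup; from∈)
import Data.List.Relation.Binary.Sublist.Propositional.Properties as Sublist
open import Data.List.Relation.Binary.Pointwise as Pointwise using (Pointwise; []; _∷_)
open import Relation.Binary.PropositionalEquality hiding ([_])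

range : ℕ → ℕ → List ℕ
range i zero    = []
range i (suc k) = i ∷ range (suc i) k

length-range : ∀ i k → length (range i k) ≡ k
length-range i zero    = refl
length-range i (suc k) = cong suc (length-range (suc i) k)

range-++ : ∀ i j k → range i (j + k) ≡ range i j ++ range (i + j) k
range-++ i zero    k = cong (λ l → range l k) (sym (+-identityʳ i))
range-++ i (suc j) k =
  cong (i ∷_) (trans (range-++ (suc i) j k) (cong (λ l → range (suc i) j ++ range l k) (sym (+-suc i j))))

range-∷ʳ : ∀ n → range 1 (suc n) ≡ range 1 n ++ [ suc n ]
range-∷ʳ n = trans (cong (range 1) (+-comm 1 n)) (range-++ 1 n 1)

map-+-range : ∀ a i k → map (_+ a) (range i k) ≡ range (i + a) k
map-+-range a i zero    = refl
map-+-range a i (suc k) = cong (i + a ∷_) (map-+-range a (suc i) k)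

∈-range⁻ : ∀ {x} i k → x ∈ range i k → i ≤ x × x < i + k
∈-range⁻ i (suc k) (here refl) = ≤-refl , m<m+n i (s≤s z≤n)
∈-range⁻ {x} i (suc k) (there x∈) with ∈-range⁻ (suc i) k x∈
... | i<x , x<i+k = <⇒≤ i<x , subst (x <_) (sym (+-suc i k)) x<i+k

map-suc-upTo : ∀ n → map suc (upTo n) ≡ range 1 n
map-suc-upTo zero    = refl
map-suc-upTo (suc n) = begin
  map suc (upTo (suc n))       ≡⟨ cong (map suc) (sym (upTo-∷ʳ n)) ⟩
  map suc (upTo n ++ [ n ])    ≡⟨ map-++ suc (upTo n) [ n ] ⟩
  map suc (upTo n) ++ [ suc n ] ≡⟨ cong (_++ [ suc n ]) (map-suc-upTo n) ⟩
  range 1 n ++ range (1 + n) 1  ≡⟨ sym (range-++ 1 n 1) ⟩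
  range 1 (n + 1)               ≡⟨ cong (range 1) (+-comm n 1) ⟩
  range 1 (suc n)               ∎
  where open ≡-Reasoning

map-∸-map-+ : ∀ k xs → map (_∸ k) (map (_+ k) xs) ≡ xs
map-∸-map-+ k xs = trans (sym (map-∘ xs)) (trans (map-cong (λ x → m+n∸n≡m x k) xs) (map-id xs))

map-+-+ : ∀ b c X → map (_+ (b + c)) X ≡ map (_+ c) (map (_+ b) X)
map-+-+ b c X = trans (map-cong (λ x → sym (+-assoc x b c)) X) (map-∘ X)

drop-length-++ : ∀ (xs : List ℕ) ys → drop (length xs) (xs ++ ys) ≡ ys
drop-length-++ []       ys = refl
drop-length-++ (x ∷ xs) ys = drop-length-++ xs ys

length-++-∷ : ∀ X (t : ℕ) Y → length (X ++ t ∷ Y) ≡ suc (length X + length Y)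
length-++-∷ X t Y = trans (length-++ X) (+-suc (length X) (length Y))

Unique-++⇒≢ : ∀ {x y : ℕ} xs {ys} → Unique (xs ++ ys) → x ∈ xs → y ∈ ys → x ≢ y
Unique-++⇒≢ (z ∷ xs) (z≢ ∷ _) (here refl) y∈ = All.lookup z≢ (∈-++⁺ʳ xs y∈)
Unique-++⇒≢ (z ∷ xs) (_ ∷ u)  (there x∈)  y∈ = Unique-++⇒≢ xs u x∈ y∈

filter-≤-split : ∀ t {us vs} → All (_≤ t) us → All (t <_) vs →
                 filter (_≤? t) (us ++ vs) ≡ us × filter (t <?_) (us ++ vs) ≡ vs
filter-≤-split t {us} {vs} us≤t t<vs =
  trans (filter-++ (_≤? t) us vs)
        (trans (cong₂ _++_ (filter-all (_≤? t) us≤t) (filter-none (_≤? t) (All.map <⇒≱ t<vs))) (++-identityʳ us))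
  , trans (filter-++ (t <?_) us vs)
          (cong₂ _++_ (filter-none (t <?_) (All.map ≤⇒≯ us≤t)) (filter-all (t <?_) t<vs))

maxL-ub : ∀ {x} xs → x ∈ xs → x ≤ maxL xs
maxL-ub (y ∷ ys) (here refl) = m≤m⊔n y (maxL ys)
maxL-ub (y ∷ ys) (there x∈)  = ≤-trans (maxL-ub ys x∈) (m≤n⊔m y (maxL ys))

maxL-lub : ∀ {b} xs → All (_≤ b) xs → maxL xs ≤ b
maxL-lub []       []         = z≤n
maxL-lub (y ∷ ys) (y≤ ∷ ys≤) = ⊔-lub y≤ (maxL-lub ys ys≤)

maxL-∈ : ∀ x xs → maxL (x ∷ xs) ∈ x ∷ xs
maxL-∈ x []       rewrite ⊔-identityʳ x = here refl
maxL-∈ x (y ∷ ys) with ⊔-sel x (maxL (y ∷ ys))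
... | inj₁ ≡x rewrite ≡x = here refl
... | inj₂ ≡m rewrite ≡m = there (maxL-∈ y ys)

maxL-++-[] : ∀ {m} xs → All (_≤ m) xs → maxL (xs ++ [ m ]) ≡ m
maxL-++-[] xs xs≤m = ≤-antisym (maxL-lub (xs ++ _) (All.++⁺ xs≤m (≤-refl ∷ [])))
                               (maxL-ub (xs ++ _) (∈-++⁺ʳ xs (here refl)))

length-⊕ : ∀ α β → length (α ⊕ β) ≡ length α + length β
length-⊕ α β = trans (length-++ α) (cong (length α +_) (length-map _ β))

length-⊖ : ∀ α β → length (α ⊖ β) ≡ length α + length β
length-⊖ α β = trans (length-++ (map _ α)) (cong (_+ length β) (length-map _ α))

⊖-identityʳ : ∀ X → X ⊖ [] ≡ X
⊖-identityʳ X = trans (++-identityʳ _) (trans (map-cong +-identityʳ X) (map-id X))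

⊖-assoc : ∀ X Y Z → X ⊖ (Y ⊖ Z) ≡ (X ⊖ Y) ⊖ Z
⊖-assoc X Y Z = begin
  map (_+ length (Y ⊖ Z)) X ++ (map (_+ c) Y ++ Z)    ≡⟨ cong (λ n → map (_+ n) X ++ Y′) (length-⊖ Y Z) ⟩
  map (_+ (b + c)) X ++ (map (_+ c) Y ++ Z)           ≡⟨ cong (_++ (map (_+ c) Y ++ Z)) (map-+-+ b c X) ⟩
  map (_+ c) (map (_+ b) X) ++ (map (_+ c) Y ++ Z)    ≡⟨ ++-assoc (map (_+ c) (map (_+ b) X)) _ Z ⟨
  (map (_+ c) (map (_+ b) X) ++ map (_+ c) Y) ++ Z    ≡⟨ cong (_++ Z) (map-++ (_+ c) (map (_+ b) X) Y) ⟨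
  map (_+ c) (map (_+ b) X ++ Y) ++ Z                 ∎
  where
  open ≡-Reasoning
  b = length Y
  c = length Z
  Y′ = map (_+ c) Y ++ Z

⊖-⊆-⊕[1]⊖ : ∀ X Z → X ⊖ Z ⊆ (X ⊕ [ 1 ]) ⊖ Z
⊖-⊆-⊕[1]⊖ X Z = subst (X ⊖ Z ⊆_) (sym split) (Sublist.++⁺ ⊆-refl (_ ∷ʳ ⊆-refl))
  where
  c = length Z
  split : (X ⊕ [ 1 ]) ⊖ Z ≡ map (_+ c) X ++ (suc (length X) + c) ∷ Z
  split = trans (cong (_++ Z) (map-++ (_+ c) X _)) (++-assoc (map (_+ c) X) _ Z)

IsPerm⇒↭range : ∀ {xs} → IsPerm xs → xs ↭ range 1 (length xs)
IsPerm⇒↭range {xs} p = ↭-trans p (↭-reflexive (map-suc-upTo (length xs)))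

↭range⇒IsPerm : ∀ {xs n} → xs ↭ range 1 n → IsPerm xs
↭range⇒IsPerm {xs} {n} p =
  ↭-trans p (↭-reflexive (sym (trans (map-suc-upTo (length xs)) (cong (range 1) |xs|≡n))))
  where
  |xs|≡n : length xs ≡ n
  |xs|≡n = trans (↭-length p) (length-range 1 n)

IsPerm-∈ : ∀ {xs v} → IsPerm xs → v ∈ xs → 1 ≤ v × v ≤ length xs
IsPerm-∈ {xs} p v∈ with ∈-range⁻ 1 (length xs) (∈-resp-↭ (IsPerm⇒↭range p) v∈)
... | 1≤v , v<1+n = 1≤v , s≤s⁻¹ v<1+n

IsPerm⇒Unique : ∀ {xs} → IsPerm xs → Unique xs
IsPerm⇒Unique p =
  PermₛProp.Unique-resp-↭ (setoid ℕ) (↭⇒↭ₛ (↭-sym p)) (Unique.map⁺ suc-injective (Unique.upTo⁺ _))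

IsPerm⇒max∈ : ∀ {b bs} → IsPerm (b ∷ bs) → suc (length bs) ∈ b ∷ bs
IsPerm⇒max∈ {bs = bs} p = ∈-resp-↭ (↭-sym (IsPerm⇒↭range p))
  (subst (suc (length bs) ∈_) (sym (range-∷ʳ (length bs))) (∈-++⁺ʳ (range 1 (length bs)) (here refl)))

IsPerm-[] : IsPerm []
IsPerm-[] = ↭-refl

IsPerm-[1] : IsPerm [ 1 ]
IsPerm-[1] = ↭-refl

IsPerm-⊕ : ∀ {α β} → IsPerm α → IsPerm β → IsPerm (α ⊕ β)
IsPerm-⊕ {α} {β} pα pβ = ↭range⇒IsPerm (↭-trans
  (++⁺ (IsPerm⇒↭range pα) (map⁺ (_+ a) (IsPerm⇒↭range pβ)))
  (↭-reflexive (trans (cong (range 1 a ++_) (map-+-range a 1 (length β))) (sym (range-++ 1 a (length β))))))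
  where a = length α

IsPerm-⊖ : ∀ {α β} → IsPerm α → IsPerm β → IsPerm (α ⊖ β)
IsPerm-⊖ {α} {β} pα pβ = ↭range⇒IsPerm (↭-trans
  (++⁺ (map⁺ (_+ b) (IsPerm⇒↭range pα)) (IsPerm⇒↭range pβ))
  (↭-trans (↭-reflexive (cong (_++ range 1 b) (map-+-range b 1 (length α))))
  (↭-trans (++-comm (range (1 + b) (length α)) (range 1 b))
           (↭-reflexive (sym (range-++ 1 b (length α)))))))
  where b = length β

IsPerm-⊕⊖ : ∀ {α β} → IsPerm α → IsPerm β → IsPerm (α ⊕ ([ 1 ] ⊖ β))
IsPerm-⊕⊖ pα pβ = IsPerm-⊕ pα (IsPerm-⊖ IsPerm-[1] pβ)

⊕⊖-ordered : ∀ {α β} → IsPerm α → IsPerm β →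
  All (_< suc (length β) + length α) (map (_+ length α) β) ×
  All (λ x → All (x <_) (suc (length β) + length α ∷ map (_+ length α) β)) α
⊕⊖-ordered {α} {β} pα pβ = β′<t , α<tβ′
  where
  a = length α
  b = length β
  β′<t : All (_< suc b + a) (map (_+ a) β)
  β′<t = All.map⁺ (All.tabulate λ y∈ → s≤s (+-monoˡ-≤ a (proj₂ (IsPerm-∈ pβ y∈))))
  α<tβ′ : All (λ x → All (x <_) (suc b + a ∷ map (_+ a) β)) α
  α<tβ′ = All.tabulate λ x∈ → let x≤a = proj₂ (IsPerm-∈ pα x∈) in
    s≤s (≤-trans x≤a (m≤n+m a b))
    ∷ All.map⁺ (All.tabulate λ y∈ → ≤-<-trans x≤a (m<n+m a (proj₁ (IsPerm-∈ pβ y∈))))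

-- Thresholding at t = maxL xs separates xs from ys on both sides of the permutation.
↭range-split : ∀ {xs ys n} → xs ++ ys ↭ range 1 n → All (λ x → All (x <_) ys) xs →
               xs ↭ range 1 (length xs) × ys ↭ range (1 + length xs) (length ys)
↭range-split {xs} {ys} {n} p xs<ys =
  subst (λ l → xs ↭ range 1 l) (sym |xs|≡t) xs↭ ,
  subst₂ (λ l l′ → ys ↭ range (1 + l) l′) (sym |xs|≡t) (sym |ys|≡n∸t) ys↭
  where
  t = maxL xs
  bounds : ∀ {v} → v ∈ xs ++ ys → 1 ≤ v × v < 1 + n
  bounds v∈ = ∈-range⁻ 1 n (∈-resp-↭ p v∈)
  t<ys : All (t <_) ys
  t<ys = All.tabulate λ {y} y∈ →
    maxL-below y (proj₁ (bounds (∈-++⁺ʳ xs y∈))) (All.map (λ x<ys → All.lookup x<ys y∈) xs<ys)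
    where
    maxL-below : ∀ y → 1 ≤ y → All (_< y) xs → t < y
    maxL-below (suc y) _ xs<y = s≤s (maxL-lub xs (All.map s≤s⁻¹ xs<y))
  t≤n : t ≤ n
  t≤n = maxL-lub xs (All.tabulate λ x∈ → s≤s⁻¹ (proj₂ (bounds (∈-++⁺ˡ x∈))))
  R₁ = range 1 t
  R₂ = range (1 + t) (n ∸ t)
  range-split : range 1 n ≡ R₁ ++ R₂
  range-split = trans (cong (range 1) (sym (m+[n∸m]≡n t≤n))) (range-++ 1 t (n ∸ t))
  split-xs++ys : filter (_≤? t) (xs ++ ys) ≡ xs × filter (t <?_) (xs ++ ys) ≡ ys
  split-xs++ys = filter-≤-split t (All.tabulate (maxL-ub xs)) t<ys
  split-range : filter (_≤? t) (R₁ ++ R₂) ≡ R₁ × filter (t <?_) (R₁ ++ R₂) ≡ R₂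
  split-range = filter-≤-split t (All.tabulate λ v∈ → s≤s⁻¹ (proj₂ (∈-range⁻ 1 t v∈)))
                                 (All.tabulate λ v∈ → proj₁ (∈-range⁻ (1 + t) (n ∸ t) v∈))
  p′ : xs ++ ys ↭ R₁ ++ R₂
  p′ = ↭-trans p (↭-reflexive range-split)
  xs↭ : xs ↭ R₁
  xs↭ = subst₂ _↭_ (proj₁ split-xs++ys) (proj₁ split-range) (filter-↭ (_≤? t) p′)
  ys↭ : ys ↭ R₂
  ys↭ = subst₂ _↭_ (proj₂ split-xs++ys) (proj₂ split-range) (filter-↭ (t <?_) p′)
  |xs|≡t : length xs ≡ t
  |xs|≡t = trans (↭-length xs↭) (length-range 1 t)
  |ys|≡n∸t : length ys ≡ n ∸ t
  |ys|≡n∸t = trans (↭-length ys↭) (length-range (1 + t) (n ∸ t))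

OrdIso-refl : ∀ xs → OrdIso xs xs
OrdIso-refl []       = []
OrdIso-refl (x ∷ xs) = Pointwise.refl (⇔.refl , ⇔.refl) ∷ OrdIso-refl xs

⊆⇒Contains : ∀ {π τ} → τ ⊆ π → Contains π τ
⊆⇒Contains {τ = τ} τ⊆π = τ , τ⊆π , OrdIso-refl τ

Has231 : List ℕ → Set
Has231 L = ∃ λ p → ∃ λ q → ∃ λ r → (p ∷ q ∷ r ∷ []) ⊆ L × r < p × p < q

Contains231⇒Has231 : ∀ {L} → Contains L p231 → Has231 L
Contains231⇒Has231 (p ∷ q ∷ r ∷ [] , τ⊆L , ((p<q⇔ , _) ∷ (_ , r<p⇔) ∷ []) ∷ _) =
  p , q , r , τ⊆L , Equivalence.from r<p⇔ (s<s z<s) , Equivalence.from p<q⇔ (s<s (s<s z<s))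

Has231⇒Contains231 : ∀ {L} → Has231 L → Contains L p231
Has231⇒Contains231 (p , q , r , τ⊆L , r<p , p<q) = p ∷ q ∷ r ∷ [] , τ⊆L , iso
  where
  agree : ∀ {a b c d} → a < b → c < d → ((a < b) ⇔ (c < d)) × ((b < a) ⇔ (d < c))
  agree a<b c<d = mk⇔ (λ _ → c<d) (λ _ → a<b) , mk⇔ (⊥-elim ∘ <-asym a<b) (⊥-elim ∘ <-asym c<d)
  iso : OrdIso (p ∷ q ∷ r ∷ []) p231
  iso = (agree p<q (s<s (s<s z<s)) ∷ swap (agree r<p (s<s z<s)) ∷ [])
      ∷ (swap (agree (<-trans r<p p<q) (s<s z<s)) ∷ [])
      ∷ ([] ∷ [])

Avoids-⊆ : ∀ {L L′ σ} → L ⊆ L′ → Avoids L′ σ → Avoids L σ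
Avoids-⊆ L⊆L′ av (τ , τ⊆L , iso) = av (τ , ⊆-trans τ⊆L L⊆L′ , iso)

⊆-map⁻ : ∀ {f : ℕ → ℕ} {xs} L → xs ⊆ map f L → ∃ λ ys → ys ⊆ L × xs ≡ map f ys
⊆-map⁻ []      []          = [] , [] , refl
⊆-map⁻ (y ∷ L) (_ ∷ʳ xs⊆) with ⊆-map⁻ L xs⊆
... | ys , ys⊆L , refl = ys , y ∷ʳ ys⊆L , refl
⊆-map⁻ (y ∷ L) (refl ∷ xs⊆) with ⊆-map⁻ L xs⊆
... | ys , ys⊆L , refl = y ∷ ys , refl ∷ ys⊆L , refl

Has231-map-+⁻ : ∀ a {L} → Has231 (map (_+ a) L) → Has231 L
Has231-map-+⁻ a {L} (_ , _ , _ , τ⊆ , r<p , p<q) with ⊆-map⁻ L τ⊆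
... | p ∷ q ∷ r ∷ [] , τ⊆L , refl = p , q , r , τ⊆L , +-cancelʳ-< a r p r<p , +-cancelʳ-< a p q p<q

Has231-map-+⁺ : ∀ a {L} → Has231 L → Has231 (map (_+ a) L)
Has231-map-+⁺ a (p , q , r , τ⊆L , r<p , p<q) =
  p + a , q + a , r + a , Sublist.map⁺ (_+ a) τ⊆L , +-monoˡ-< a r<p , +-monoˡ-< a p<q

⊆-++⁻ : ∀ {ys : List ℕ} X Z → ys ⊆ X ++ Z → ∃₂ λ ys₁ ys₂ → ys ≡ ys₁ ++ ys₂ × ys₁ ⊆ X × ys₂ ⊆ Z
⊆-++⁻ []      Z ys⊆ = [] , _ , refl , [] , ys⊆
⊆-++⁻ (x ∷ X) Z (.x ∷ʳ ys⊆) with ⊆-++⁻ X Z ys⊆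
... | ys₁ , ys₂ , refl , ys₁⊆ , ys₂⊆ = ys₁ , ys₂ , refl , x ∷ʳ ys₁⊆ , ys₂⊆
⊆-++⁻ (x ∷ X) Z (refl ∷ ys⊆) with ⊆-++⁻ X Z ys⊆
... | ys₁ , ys₂ , refl , ys₁⊆ , ys₂⊆ = x ∷ ys₁ , ys₂ , refl , refl ∷ ys₁⊆ , ys₂⊆

-- The '2' of a 231 lies in X only if the whole pattern does: everything after X is above it.
¬Has231-++-∷ : ∀ {X t Y} → ¬ Has231 X → ¬ Has231 Y → All (_< t) Y →
               All (λ x → All (x <_) (t ∷ Y)) X → ¬ Has231 (X ++ t ∷ Y)
¬Has231-++-∷ {X} {t} {Y} ¬X ¬Y Y<t X<tY (p , q , r , τ⊆ , r<p , p<q) with ⊆-++⁻ X (t ∷ Y) τ⊆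
... | [] , _ , refl , _ , (.t ∷ʳ τ⊆Y) = ¬Y (p , q , r , τ⊆Y , r<p , p<q)
... | [] , _ , refl , _ , (refl ∷ qr⊆Y) = <-asym p<q (All.lookup Y<t (lookup qr⊆Y (here refl)))
... | p ∷ [] , _ , refl , p⊆X , qr⊆ =
  <-asym r<p (All.lookup (All.lookup X<tY (lookup p⊆X (here refl))) (lookup qr⊆ (there (here refl))))
... | p ∷ q ∷ [] , _ , refl , pq⊆X , r⊆ =
  <-asym r<p (All.lookup (All.lookup X<tY (lookup pq⊆X (here refl))) (lookup r⊆ (here refl)))
... | p ∷ q ∷ r ∷ [] , [] , refl , τ⊆X , _ = ¬X (p , q , r , τ⊆X , r<p , p<q)

Avoids231-map-+ : ∀ a {L} → Avoids (map (_+ a) L) p231 → Avoids L p231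
Avoids231-map-+ a av = av ∘ Has231⇒Contains231 ∘ Has231-map-+⁺ a ∘ Contains231⇒Has231

[]∈Av231 : InAv1 p231 []
[]∈Av231 = IsPerm-[] , λ { (_ , [] , ()) }

InAv231-⊕⊖ : ∀ {α β} → InAv1 p231 α → InAv1 p231 β → InAv1 p231 (α ⊕ ([ 1 ] ⊖ β))
InAv231-⊕⊖ {α} (pα , avα) (pβ , avβ) with β′<t , α<tβ′ ← ⊕⊖-ordered pα pβ =
  IsPerm-⊕⊖ pα pβ ,
  ¬Has231-++-∷ (avα ∘ Has231⇒Contains231) (avβ ∘ Has231⇒Contains231 ∘ Has231-map-+⁻ (length α))
               β′<t α<tβ′
    ∘ Contains231⇒Has231

Avoids231⇒ascending : ∀ {X t Y} → Unique (X ++ Y) → All (_< t) X → Avoids (X ++ t ∷ Y) p231 →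
                      All (λ x → All (x <_) Y) X
Avoids231⇒ascending {X} {t} {Y} uniq X<t av = All.tabulate λ x∈ → All.tabulate λ y∈ → ascending x∈ y∈
  where
  ascending : ∀ {x y} → x ∈ X → y ∈ Y → x < y
  ascending {x} {y} x∈ y∈ with <-cmp x y
  ... | tri< x<y _ _ = x<y
  ... | tri≈ _ x≡y _ = ⊥-elim (Unique-++⇒≢ X uniq x∈ y∈ x≡y)
  ... | tri> _ _ y<x = ⊥-elim (av (Has231⇒Contains231
          (x , t , y , Sublist.++⁺ (from∈ x∈) (refl ∷ from∈ y∈) , y<x , All.lookup X<t x∈)))

split-at-max : ∀ {X n Y} → X ++ suc n ∷ Y ↭ range 1 (suc n) → Avoids (X ++ suc n ∷ Y) p231 →
               ∃ λ γ → InAv1 p231 X × InAv1 p231 γ × X ++ suc n ∷ Y ≡ X ⊕ ([ 1 ] ⊖ γ)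
split-at-max {X} {n} {Y} p av =
  γ , (↭range⇒IsPerm X↭ , Avoids-⊆ X⊆ av)
    , (↭range⇒IsPerm γ↭ , Avoids231-map-+ k (subst (λ Z → Avoids Z p231) (sym Y≡) (Avoids-⊆ Y⊆ av)))
    , cong₂ (λ m Z → X ++ m ∷ Z) n≡ (sym Y≡)
  where
  k = length X
  l = length Y
  XY↭ : X ++ Y ↭ range 1 n
  XY↭ = ↭-trans (drop-mid X (range 1 n) (↭-trans p (↭-reflexive (range-∷ʳ n))))
                (↭-reflexive (++-identityʳ _))
  X<Y : All (λ x → All (x <_) Y) X
  X<Y = Avoids231⇒ascending (IsPerm⇒Unique (↭range⇒IsPerm XY↭))
          (All.tabulate λ x∈ → proj₂ (∈-range⁻ 1 n (∈-resp-↭ XY↭ (∈-++⁺ˡ x∈)))) av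
  X↭ : X ↭ range 1 k
  X↭ = proj₁ (↭range-split XY↭ X<Y)
  Y↭ : Y ↭ range (1 + k) l
  Y↭ = proj₂ (↭range-split XY↭ X<Y)
  γ = map (_∸ k) Y
  γ↭ : γ ↭ range 1 l
  γ↭ = ↭-trans (map⁺ (_∸ k) Y↭)
         (↭-reflexive (trans (cong (map (_∸ k)) (sym (map-+-range k 1 l))) (map-∸-map-+ k _)))
  Y≡ : map (_+ k) γ ≡ Y
  Y≡ = trans (sym (map-∘ Y)) (map-id-local (All.tabulate λ y∈ →
         m∸n+n≡m (<⇒≤ (proj₁ (∈-range⁻ (1 + k) l (∈-resp-↭ Y↭ y∈))))))
  n≡ : suc n ≡ suc (length γ) + k
  n≡ = cong suc (begin
    n             ≡⟨ trans (sym (length-++ X)) (trans (↭-length XY↭) (length-range 1 n)) ⟨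
    k + l         ≡⟨ +-comm k l ⟩
    l + k         ≡⟨ cong (_+ k) (length-map _ Y) ⟨
    length γ + k  ∎)
    where open ≡-Reasoning
  X⊆ : X ⊆ X ++ suc n ∷ Y
  X⊆ = Sublist.++⁺ʳ (suc n ∷ Y) ⊆-refl
  Y⊆ : Y ⊆ X ++ suc n ∷ Y
  Y⊆ = Sublist.++⁺ˡ X (suc n ∷ʳ ⊆-refl)

⊕⊖-decomposition : ∀ {β} → InAv1 p231 β →
  β ≡ [] ⊎ ∃₂ λ β₁ γ → InAv1 p231 β₁ × InAv1 p231 γ × β ≡ β₁ ⊕ ([ 1 ] ⊖ γ)
⊕⊖-decomposition {[]} _ = inj₁ refl
⊕⊖-decomposition {b ∷ bs} (pβ , avβ)
  with X , Y , β≡ ← ∈-∃++ (IsPerm⇒max∈ pβ)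
  with γ , X∈ , γ∈ , ≡⊕⊖ ← split-at-max (subst (_↭ _) β≡ (IsPerm⇒↭range pβ))
                                          (subst (λ xs → Avoids xs p231) β≡ avβ)
  = inj₂ (X , γ , X∈ , γ∈ , trans β≡ ≡⊕⊖)

span-≢ : ∀ {m} X Y → All (_≢ m) X → span (λ y → ¬? (y ≟ m)) (X ++ m ∷ Y) ≡ (X , m ∷ Y)
span-≢ {m} []      Y []           rewrite dec-true (m ≟ m) refl = refl
span-≢ {m} (x ∷ X) Y (x≢m ∷ X≢m) rewrite dec-false (x ≟ m) x≢m | span-≢ X Y X≢m = refl

Pf-step : ∀ k X t Y → maxL (X ++ t ∷ Y) ≡ t → All (_≢ t) X →
          Pf (suc k) (X ++ t ∷ Y) ≡ (Pf k X ⊕ [ 1 ]) ⊖ Pf k (map (_∸ length X) Y)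
Pf-step k []      t Y max≡t X≢t rewrite max≡t | span-≢ [] Y X≢t = refl
Pf-step k (x ∷ X) t Y max≡t X≢t rewrite max≡t | span-≢ (x ∷ X) Y X≢t = refl

∈⇒first-split : ∀ {m : ℕ} {xs} → m ∈ xs → ∃₂ λ X Y → xs ≡ X ++ m ∷ Y × All (_≢ m) X
∈⇒first-split {m} {x ∷ xs} m∈ with x ≟ m | m∈
... | yes refl | _          = [] , xs , refl , []
... | no x≢m   | here m≡x   = ⊥-elim (x≢m (sym m≡x))
... | no x≢m   | there m∈xs with X , Y , refl , X≢m ← ∈⇒first-split m∈xs = x ∷ X , Y , refl , x≢m ∷ X≢m

Pf-fuel : ∀ k k′ xs → length xs ≤ k → length xs ≤ k′ → Pf k xs ≡ Pf k′ xs
Pf-fuel zero     zero      []       _ _ = refl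
Pf-fuel zero     (suc k′)  []       _ _ = refl
Pf-fuel (suc k)  zero      []       _ _ = refl
Pf-fuel (suc k)  (suc k′)  []       _ _ = refl
Pf-fuel (suc k)  (suc k′)  (x ∷ xs) ≤k ≤k′ with ∈⇒first-split (maxL-∈ x xs)
... | X , Y , xs≡ , X≢m = begin
  Pf (suc k) (x ∷ xs)             ≡⟨ cong (Pf (suc k)) xs≡ ⟩
  Pf (suc k) (X ++ m ∷ Y)         ≡⟨ Pf-step k X m Y max≡m X≢m ⟩
  (Pf k X ⊕ [ 1 ]) ⊖ Pf k Y′      ≡⟨ cong₂ (λ A B → (A ⊕ [ 1 ]) ⊖ B) (Pf-fuel k k′ X (X≤ ≤k) (X≤ ≤k′))
                                                                    (Pf-fuel k k′ Y′ (Y′≤ ≤k) (Y′≤ ≤k′)) ⟩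
  (Pf k′ X ⊕ [ 1 ]) ⊖ Pf k′ Y′    ≡⟨ Pf-step k′ X m Y max≡m X≢m ⟨
  Pf (suc k′) (X ++ m ∷ Y)        ≡⟨ cong (Pf (suc k′)) xs≡ ⟨
  Pf (suc k′) (x ∷ xs)            ∎
  where
  open ≡-Reasoning
  m = maxL (x ∷ xs)
  Y′ = map (_∸ length X) Y
  max≡m : maxL (X ++ m ∷ Y) ≡ m
  max≡m = cong maxL (sym xs≡)
  |xs| : length (x ∷ xs) ≡ suc (length X + length Y)
  |xs| = trans (cong length xs≡) (length-++-∷ X m Y)
  X≤ : ∀ {j} → length (x ∷ xs) ≤ suc j → length X ≤ j
  X≤ {j} ≤j = ≤-trans (m≤m+n (length X) (length Y)) (s≤s⁻¹ (subst (_≤ suc j) |xs| ≤j))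
  Y′≤ : ∀ {j} → length (x ∷ xs) ≤ suc j → length Y′ ≤ j
  Y′≤ {j} ≤j = ≤-trans (≤-reflexive (length-map _ Y))
                       (≤-trans (m≤n+m (length Y) (length X)) (s≤s⁻¹ (subst (_≤ suc j) |xs| ≤j)))

P-split : ∀ X t Y → All (_< t) X → All (_< t) Y → P (X ++ t ∷ Y) ≡ (P X ⊕ [ 1 ]) ⊖ P (map (_∸ length X) Y)
P-split X t Y X<t Y<t = begin
  P (X ++ t ∷ Y)                 ≡⟨ cong (λ k → Pf k (X ++ t ∷ Y)) (length-++-∷ X t Y) ⟩
  Pf (suc n) (X ++ t ∷ Y)        ≡⟨ Pf-step n X t Y max≡t (All.map <⇒≢ X<t) ⟩
  (Pf n X ⊕ [ 1 ]) ⊖ Pf n Y′     ≡⟨ cong₂ (λ A B → (A ⊕ [ 1 ]) ⊖ B)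
                                      (Pf-fuel n _ X (m≤m+n (length X) (length Y)) ≤-refl)
                                      (Pf-fuel n _ Y′ (≤-trans (≤-reflexive (length-map _ Y)) (m≤n+m (length Y) (length X))) ≤-refl) ⟩
  (P X ⊕ [ 1 ]) ⊖ P Y′           ∎
  where
  open ≡-Reasoning
  n = length X + length Y
  Y′ = map (_∸ length X) Y
  max≡t : maxL (X ++ t ∷ Y) ≡ t
  max≡t = ≤-antisym (maxL-lub (X ++ t ∷ Y) (All.++⁺ (All.map <⇒≤ X<t) (≤-refl ∷ All.map <⇒≤ Y<t)))
                    (maxL-ub (X ++ t ∷ Y) (∈-++⁺ʳ X (here refl)))

-- The recursive definition of P in the paper.
P-⊕⊖ : ∀ {α β} → IsPerm α → IsPerm β → P (α ⊕ ([ 1 ] ⊖ β)) ≡ (P α ⊕ [ 1 ]) ⊖ P β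
P-⊕⊖ {α} {β} pα pβ with β′<t , α<tβ′ ← ⊕⊖-ordered pα pβ =
  trans (P-split α _ (map (_+ length α) β) (All.map All.head α<tβ′) β′<t)
        (cong (λ Z → (P α ⊕ [ 1 ]) ⊖ P Z) (map-∸-map-+ (length α) β))

OrdIso-split : ∀ {τ} pre n post → OrdIso τ (pre ++ n ∷ post) → All (_< n) post →
  ∃₂ λ pre′ x → ∃ λ post′ →
    τ ≡ pre′ ++ x ∷ post′ × length pre′ ≡ length pre × length post′ ≡ length post × All (_< x) post′
OrdIso-split [] n post (_∷_ {x} {_} {post′} x~n _) post<n =
  [] , x , post′ , refl , refl , Pointwise.Pointwise-length x~n , below x~n post<n
  where
  below : ∀ {as bs} → Pointwise (λ a b → ((x < a) ⇔ (n < b)) × ((a < x) ⇔ (b < n))) as bs →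
          All (_< n) bs → All (_< x) as
  below []              []          = []
  below ((_ , <x⇔) ∷ ~) (b<n ∷ bs<n) = Equivalence.from <x⇔ b<n ∷ below ~ bs<n
OrdIso-split (_ ∷ pre) n post (_∷_ {y} _ iso) post<n with OrdIso-split pre n post iso post<n
... | pre′ , x , post′ , refl , |pre′| , |post′| , post′<x =
  y ∷ pre′ , x , post′ , refl , cong suc |pre′| , |post′| , post′<x

Contains⇒descent : ∀ {σ} pre n post → All (_< n) post → Contains σ (pre ++ n ∷ post) →
  ∃₂ λ x q → x ∷ q ⊆ drop (length pre) σ × All (_< x) q × length q ≡ length post
Contains⇒descent {σ} pre n post post<n (τ , τ⊆σ , iso) with OrdIso-split pre n post iso post<n
... | pre′ , x , q , refl , |pre′| , |q| , q<x =
  x , q , subst (_⊆ drop (length pre) σ) drop-pre (Sublist.drop⁺-⊆ (length pre) τ⊆σ) , q<x , |q|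
  where
  drop-pre : drop (length pre) (pre′ ++ x ∷ q) ≡ x ∷ q
  drop-pre = trans (cong (λ k → drop k (pre′ ++ x ∷ q)) (sym |pre′|)) (drop-length-++ pre′ (x ∷ q))

⊆-++-below : ∀ {x q} A B → q ⊆ A ++ B → All (_< x) q → All (x <_) B → length q ≤ length A
⊆-++-below {q = []}    []      B _      _          _   = z≤n
⊆-++-below {q = y ∷ q} []      B y∷q⊆B (y<x ∷ _)  x<B =
  ⊥-elim (<-asym y<x (All.lookup x<B (lookup y∷q⊆B (here refl))))
⊆-++-below             (a ∷ A) B (.a ∷ʳ q⊆) q<x x<B = m≤n⇒m≤1+n (⊆-++-below A B q⊆ q<x x<B)
⊆-++-below             (a ∷ A) B (refl ∷ q⊆) (_ ∷ q<x) x<B = s≤s (⊆-++-below A B q⊆ q<x x<B)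

descent-bound : ∀ {x q} A B → x ∷ q ⊆ A ++ B → All (_< x) q → All (λ a → All (a <_) B) A →
                length q < length A ⊎ length q < length B
descent-bound []      B x∷q⊆      _   _           = inj₂ (Sublist.length-mono-≤ x∷q⊆)
descent-bound (a ∷ A) B (.a ∷ʳ x∷q⊆) q<x (_ ∷ A<B) = Sum.map₁ m<n⇒m<1+n (descent-bound A B x∷q⊆ q<x A<B)
descent-bound (a ∷ A) B (refl ∷ q⊆)  q<x (a<B ∷ _) = inj₁ (s≤s (⊆-++-below A B q⊆ q<x a<B))

witness : List ℕ → List ℕ → List ℕ → List ℕ
witness α β₁ γ = (α ⊕ ([ 1 ] ⊖ (β₁ ⊕ [ 1 ]))) ⊕ ([ 1 ] ⊖ γ)

witness-InAv231 : ∀ {α β₁ γ} → InAv1 p231 α → InAv1 p231 β₁ → InAv1 p231 γ → InAv1 p231 (witness α β₁ γ)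
witness-InAv231 α∈ β₁∈ γ∈ = InAv231-⊕⊖ (InAv231-⊕⊖ α∈ (InAv231-⊕⊖ β₁∈ []∈Av231)) γ∈

witness-avoids : ∀ {α β₁ γ} → IsPerm α → IsPerm β₁ → IsPerm γ → 0 < length γ →
                 Avoids (witness α β₁ γ) (α ⊕ ([ 1 ] ⊖ (β₁ ⊕ ([ 1 ] ⊖ γ))))
witness-avoids {α} {β₁} {γ} pα pβ₁ pγ 0<c occ =
  refute (Contains⇒descent α _ (map (_+ a) β) (proj₁ (⊕⊖-ordered pα pβ)) occ)
  where
  a = length α
  k = length β₁
  c = length γ
  β = β₁ ⊕ ([ 1 ] ⊖ γ)
  pβ : IsPerm β
  pβ = IsPerm-⊕⊖ pβ₁ pγ
  L = α ⊕ ([ 1 ] ⊖ (β₁ ⊕ [ 1 ]))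
  pL : IsPerm L
  pL = IsPerm-⊕⊖ pα (IsPerm-⊕⊖ pβ₁ IsPerm-[])
  A = map (_+ a) ([ 1 ] ⊖ (β₁ ⊕ [ 1 ]))
  B = map (_+ length L) ([ 1 ] ⊖ γ)
  drop≡ : drop a (witness α β₁ γ) ≡ A ++ B
  drop≡ = trans (cong (drop a) (++-assoc α A B)) (drop-length-++ α (A ++ B))
  A<B : All (λ u → All (u <_) B) A
  A<B = All.map (λ u≤ → All.map (≤-<-trans u≤) |L|<B) A≤|L|
    where
    A≤|L| : All (_≤ length L) A
    A≤|L| = All.++⁻ʳ α (All.tabulate (proj₂ ∘ IsPerm-∈ pL))
    |L|<B : All (length L <_) B
    |L|<B = All.map⁺ (All.tabulate λ v∈ → m<n+m (length L) (proj₁ (IsPerm-∈ (IsPerm-⊖ IsPerm-[1] pγ) v∈)))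
  |A| : length A ≡ suc (k + 1)
  |A| = trans (length-map (_+ a) ([ 1 ] ⊖ (β₁ ⊕ [ 1 ])))
              (trans (length-⊖ [ 1 ] (β₁ ⊕ [ 1 ])) (cong suc (length-⊕ β₁ [ 1 ])))
  |B| : length B ≡ suc c
  |B| = trans (length-map (_+ length L) ([ 1 ] ⊖ γ)) (length-⊖ [ 1 ] γ)
  |β′| : length (map (_+ a) β) ≡ k + suc c
  |β′| = trans (length-map _ β) (trans (length-⊕ β₁ ([ 1 ] ⊖ γ)) (cong (k +_) (length-⊖ [ 1 ] γ)))
  refute : (∃₂ λ x q → x ∷ q ⊆ drop a (witness α β₁ γ) × All (_< x) q × length q ≡ length (map (_+ a) β)) →
           ⊥
  refute (x , q , x∷q⊆ , q<x , |q|) with descent-bound A B (subst (x ∷ q ⊆_) drop≡ x∷q⊆) q<x A<B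
  ... | inj₁ q<A = <⇒≱ 0<c (s≤s⁻¹ (+-cancelˡ-≤ k (suc c) 1 (s≤s⁻¹ (subst₂ _<_ (trans |q| |β′|) |A| q<A))))
  ... | inj₂ q<B = <⇒≱ (subst₂ _<_ (trans |q| |β′|) |B| q<B) (m≤n+m (suc c) k)

P-witness-contains : ∀ {α β₁ γ} → IsPerm α → IsPerm β₁ → IsPerm γ →
  Contains (P (witness α β₁ γ)) (P (α ⊕ ([ 1 ] ⊖ (β₁ ⊕ ([ 1 ] ⊖ γ)))))
P-witness-contains {α} {β₁} {γ} pα pβ₁ pγ =
  ⊆⇒Contains (subst₂ _⊆_ (sym Pπ) (sym Pσ) (⊖-⊆-⊕[1]⊖ (X ⊖ Y) C))
  where
  open ≡-Reasoning
  X = P α ⊕ [ 1 ]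
  Y = P β₁ ⊕ [ 1 ]
  C = P γ
  Pπ : P (α ⊕ ([ 1 ] ⊖ (β₁ ⊕ ([ 1 ] ⊖ γ)))) ≡ (X ⊖ Y) ⊖ C
  Pπ = begin
    P (α ⊕ ([ 1 ] ⊖ (β₁ ⊕ ([ 1 ] ⊖ γ))))  ≡⟨ P-⊕⊖ pα (IsPerm-⊕⊖ pβ₁ pγ) ⟩
    X ⊖ P (β₁ ⊕ ([ 1 ] ⊖ γ))              ≡⟨ cong (X ⊖_) (P-⊕⊖ pβ₁ pγ) ⟩
    X ⊖ (Y ⊖ C)                           ≡⟨ ⊖-assoc X Y C ⟩
    (X ⊖ Y) ⊖ C                           ∎
  pβ₁⊕1 : IsPerm (β₁ ⊕ [ 1 ])
  pβ₁⊕1 = IsPerm-⊕⊖ pβ₁ IsPerm-[]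
  P[β₁⊕1] : P (β₁ ⊕ [ 1 ]) ≡ Y
  P[β₁⊕1] = trans (P-⊕⊖ pβ₁ IsPerm-[]) (⊖-identityʳ Y)
  Pσ : P (witness α β₁ γ) ≡ ((X ⊖ Y) ⊕ [ 1 ]) ⊖ C
  Pσ = begin
    P (witness α β₁ γ)                            ≡⟨ P-⊕⊖ (IsPerm-⊕⊖ pα pβ₁⊕1) pγ ⟩
    (P (α ⊕ ([ 1 ] ⊖ (β₁ ⊕ [ 1 ]))) ⊕ [ 1 ]) ⊖ C  ≡⟨ cong (λ Z → (Z ⊕ [ 1 ]) ⊖ C) (P-⊕⊖ pα pβ₁⊕1) ⟩
    ((X ⊖ P (β₁ ⊕ [ 1 ])) ⊕ [ 1 ]) ⊖ C           ≡⟨ cong (λ Z → ((X ⊖ Z) ⊕ [ 1 ]) ⊖ C) P[β₁⊕1] ⟩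
    ((X ⊖ Y) ⊕ [ 1 ]) ⊖ C                         ∎

¬PRestrictsBij : ∀ {α β₁ γ} → InAv1 p231 α → InAv1 p231 β₁ → InAv1 p231 γ → 0 < length γ →
                 ¬ PRestrictsBij (α ⊕ ([ 1 ] ⊖ (β₁ ⊕ ([ 1 ] ⊖ γ))))
¬PRestrictsBij α∈ β₁∈ γ∈ 0<c (P-maps-into , _)
  with pσ , σ-avoids-231 ← witness-InAv231 α∈ β₁∈ γ∈
  with _ , _ , Pσ-avoids-Pπ ←
         P-maps-into _ (pσ , σ-avoids-231 , witness-avoids (proj₁ α∈) (proj₁ β₁∈) (proj₁ γ∈) 0<c)
  = Pσ-avoids-Pπ (P-witness-contains (proj₁ α∈) (proj₁ β₁∈) (proj₁ γ∈))

mainTheorem18 : (α β : List ℕ) → InAv1 p231 α → InAv1 p231 β →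
    PRestrictsBij (α ⊕ ([ 1 ] ⊖ β)) → EndsWithMax β
mainTheorem18 α β α∈ β∈ bij with ⊕⊖-decomposition β∈
... | inj₁ refl = inj₁ refl
... | inj₂ (β₁ , [] , (pβ₁ , _) , _ , refl) =
  inj₂ (β₁ , cong (λ m → β₁ ++ [ m ]) (sym (maxL-++-[] β₁ (All.tabulate (m≤n⇒m≤1+n ∘ proj₂ ∘ IsPerm-∈ pβ₁)))))
... | inj₂ (β₁ , γ@(_ ∷ _) , β₁∈ , γ∈ , refl) = ⊥-elim (¬PRestrictsBij α∈ β₁∈ γ∈ z<s bij)
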